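{- Let $T$ be a BST, $\tau$ a connected subtree of $T$ containing the root of $T$, and $y$ a key. Suppose that $\mathrm{pred}_T(y)\in\tau$, or $\mathrm{succ}_T(y)\in\tau$, or $y$ is the minimum or maximum element (among the keys of $T$ together with $y$). Then (i) if $y\notin T$, every reconfiguration $\tau\to\tau'$ where $\tau'$ is a BST with $\mathrm{keys}(\tau')=\mathrm{keys}(\tau)\cup\{y\}$ is valid; and (ii) if $y\in\tau$, every reconfiguration $\tau\to\tau'$ where $\tau'$ is a BST with $\mathrm{keys}(\tau)=\mathrm{keys}(\tau')\cup\{y\}$, $y\notin\tau'$, is valid.
   Context: A BST is a binary search tree on distinct keys (integers). For a BST $T$ and key $y$, $\mathrm{pred}_T(y)$ (resp. $\mathrm{succ}_T(y)$) is the largest (resp. smallest) key of $T$ other than $y$ that is smaller (resp. larger) than $y$. Given a BST $T_1$, a connected subtree $\tau$ of $T_1$ containing the root, and a BST $\tau'$ whose key set equals that of $\tau$, or that of $\tau$ plus one key not in $T_1$, or that of $\tau$ minus one key, the reconfiguration $\tau\to\tau'$ is valid if there is a BST $T_2$ on $(\mathrm{keys}(T_1)\setminus\mathrm{keys}(\tau))\cup\mathrm{keys}(\tau')$ in which $\tau'$ is the connected subtree containing the root on the keys of $\tau'$, and every node of $T_1$ not in $\tau$ has the same left and right children in $T_2$ as in $T_1$. -}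

module Defs where

open import Data.Integer using (ℤ; _<_; _≤_)
open import Data.Maybe using (Maybe; just; nothing)
open import Data.Product using (Σ; ∃; _×_; _,_)
open import Data.Sum using (_⊎_)
open import Data.Unit using (⊤)
open import Relation.Nullary using (¬_)
open import Relation.Binary.PropositionalEquality using (_≡_)

data Tree : Set where
  leaf : Tree
  node : Tree → ℤ → Tree → Tree

data _∈ₜ_ (x : ℤ) : Tree → Set where
  here  : ∀ {l r} → x ∈ₜ node l x r
  left  : ∀ {l k r} → x ∈ₜ l → x ∈ₜ node l k r
  right : ∀ {l k r} → x ∈ₜ r → x ∈ₜ node l k r

IsBST : Tree → Set
IsBST leaf = ⊤
IsBST (node l k r) = IsBST l × IsBST r
                   × (∀ x → x ∈ₜ l → x < k) × (∀ x → x ∈ₜ r → k < x)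

root : Tree → Maybe ℤ
root leaf = nothing
root (node _ k _) = just k

-- 'Prefix τ T': τ is a connected subtree of T containing the root of T
-- (or empty), i.e. T is obtained from τ by hanging subtrees at leaves of τ.
data Prefix : Tree → Tree → Set where
  pleaf : ∀ {T} → Prefix leaf T
  pnode : ∀ {l k r l' r'} → Prefix l l' → Prefix r r' →
          Prefix (node l k r) (node l' k r')

NonEmpty : Tree → Set
NonEmpty t = Σ Tree λ l → Σ ℤ λ k → Σ Tree λ r → t ≡ node l k r

data NodeAt : Tree → ℤ → Tree → Tree → Set where
  at    : ∀ {l k r} → NodeAt (node l k r) k l r
  inL   : ∀ {l m r k a b} → NodeAt l k a b → NodeAt (node l m r) k a b
  inR   : ∀ {l m r k a b} → NodeAt r k a b → NodeAt (node l m r) k a b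

IsPred : Tree → ℤ → ℤ → Set
IsPred T y p = p ∈ₜ T × p < y × (∀ x → x ∈ₜ T → x < y → x ≤ p)

IsSucc : Tree → ℤ → ℤ → Set
IsSucc T y s = s ∈ₜ T × y < s × (∀ x → x ∈ₜ T → y < x → s ≤ x)

ValidReconf : Tree → Tree → Tree → Set
ValidReconf T τ τ' =
  Σ Tree λ T₂ →
      IsBST T₂
    × (∀ x → (x ∈ₜ T₂ → ((x ∈ₜ T × ¬ (x ∈ₜ τ)) ⊎ x ∈ₜ τ'))
           × (((x ∈ₜ T × ¬ (x ∈ₜ τ)) ⊎ x ∈ₜ τ') → x ∈ₜ T₂))
    × Prefix τ' T₂
    × (∀ k l r → NodeAt T k l r → ¬ (k ∈ₜ τ) →
         Σ Tree λ l₂ → Σ Tree λ r₂ →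
           NodeAt T₂ k l₂ r₂ × root l₂ ≡ root l × root r₂ ≡ root r)

module Submission where

-- The keys of T outside τ form pendant subtrees hanging at the leaves of τ.
-- T₂ is built by grafting onto each leaf of τ', with window (lo, hi), the
-- pendant subtree reached by routing through τ towards that window (kept
-- only if its root lies in the window).  'Criterion.valid' shows that T₂
-- witnesses validity provided no key outside τ is a key of τ', no key of τ'
-- separates two keys of one pendant, and in every window free of τ'-keys the
-- keys of τ lie on a fixed side of those outside τ.  After windows, bounded
-- BSTs, pendants, filtering and grafting, the criterion is proved; the anchor
-- condition then supplies its hypotheses for insertion (y splits no pendant)
-- and deletion (the merged window receives only one nonempty pendant).

open import Defs
open import Data.Integer using (ℤ; _<_; _≤_)
open import Data.Integer.Properties
  using (<-cmp; ≮⇒≥; <⇒≤; <-asym; <-irrefl; ≤-<-trans; <-≤-trans; <-trans; _<?_)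
open import Data.Bool using (Bool; true; false; if_then_else_)
open import Data.Maybe using (Maybe; just; nothing)
open import Data.Product using (Σ; _×_; _,_; proj₁; proj₂)
open import Data.Sum using (_⊎_; inj₁; inj₂; [_,_]′)
open import Data.Unit using (⊤; tt)
open import Data.Empty using (⊥; ⊥-elim)
open import Relation.Nullary using (¬_; yes; no; Dec)
open import Relation.Nullary.Decidable using (_×-dec_)
open import Relation.Binary.PropositionalEquality using (_≡_; refl; sym; subst)
open import Relation.Binary.Definitions using (tri<; tri≈; tri>)

-- Windows: open intervals (lo, hi) whose ends may be infinite (nothing).

Above : Maybe ℤ → ℤ → Set
Above nothing  _ = ⊤
Above (just a) x = a < x

Below : Maybe ℤ → ℤ → Set
Below nothing  _ = ⊤
Below (just b) x = x < b

Within : Maybe ℤ → Maybe ℤ → ℤ → Set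
Within lo hi x = Above lo x × Below hi x

above? : ∀ lo x → Dec (Above lo x)
above? nothing  x = yes tt
above? (just a) x = a <? x

below? : ∀ hi x → Dec (Below hi x)
below? nothing  x = yes tt
below? (just b) x = x <? b

within? : ∀ lo hi x → Dec (Within lo hi x)
within? lo hi x = above? lo x ×-dec below? hi x

above-mono : ∀ lo {k x} → k ≤ x → Above lo k → Above lo x
above-mono nothing  _   _   = tt
above-mono (just a) k≤x a<k = <-≤-trans a<k k≤x

below-mono : ∀ hi {k x} → x ≤ k → Below hi k → Below hi x
below-mono nothing  _   _   = tt
below-mono (just b) x≤k k<b = ≤-<-trans x≤k k<b

left-of-window : ∀ lo {k x} → ¬ Above lo k → Above lo x → k < x
left-of-window nothing  k∉ _   = ⊥-elim (k∉ tt)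
left-of-window (just a) k∉ a<x = ≤-<-trans (≮⇒≥ k∉) a<x

right-of-window : ∀ hi {k x} → ¬ Below hi k → Below hi x → x < k
right-of-window nothing  k∉ _   = ⊥-elim (k∉ tt)
right-of-window (just b) k∉ x<b = <-≤-trans x<b (≮⇒≥ k∉)

window-left : ∀ lo hi {k v} → Below hi k → Within lo (just k) v → Within lo hi v
window-left lo hi k<hi (lo<v , v<k) = lo<v , below-mono hi (<⇒≤ v<k) k<hi

window-right : ∀ lo hi {k v} → Above lo k → Within (just k) hi v → Within lo hi v
window-right lo hi lo<k (k<v , v<hi) = above-mono lo (<⇒≤ k<v) lo<k , v<hi

EndIn : (ℤ → Set) → Maybe ℤ → Set
EndIn K nothing  = ⊤
EndIn K (just v) = K v

Gap : (ℤ → Set) → Maybe ℤ → Maybe ℤ → Set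
Gap K lo hi = ∀ v → K v → ¬ Within lo hi v

-- BSTs whose keys lie in a window; the window of each leaf is explicit.

BSTIn : Maybe ℤ → Maybe ℤ → Tree → Set
BSTIn lo hi leaf         = ⊤
BSTIn lo hi (node l k r) = Within lo hi k × BSTIn lo (just k) l × BSTIn (just k) hi r

bstIn-keys : ∀ {lo hi t x} → BSTIn lo hi t → x ∈ₜ t → Within lo hi x
bstIn-keys (wk , _ , _) here = wk
bstIn-keys {lo} {hi} (wk , bl , _) (left m)  = window-left lo hi (proj₂ wk) (bstIn-keys bl m)
bstIn-keys {lo} {hi} (wk , _ , br) (right m) = window-right lo hi (proj₁ wk) (bstIn-keys br m)

bstIn⇒bst : ∀ {lo hi t} → BSTIn lo hi t → IsBST t
bstIn⇒bst {t = leaf} _ = tt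
bstIn⇒bst {t = node l k r} (_ , bl , br) =
  bstIn⇒bst bl , bstIn⇒bst br ,
  (λ x m → proj₂ (bstIn-keys bl m)) , (λ x m → proj₁ (bstIn-keys br m))

bst⇒bstIn : ∀ {lo hi t} → IsBST t → (∀ x → x ∈ₜ t → Within lo hi x) → BSTIn lo hi t
bst⇒bstIn {t = leaf} _ _ = tt
bst⇒bstIn {t = node l k r} (bl , br , fl , fr) keys =
  keys k here ,
  bst⇒bstIn bl (λ x m → proj₁ (keys x (left m)) , fl x m) ,
  bst⇒bstIn br (λ x m → fr x m , proj₂ (keys x (right m)))

∉leaf : ∀ {x} → ¬ x ∈ₜ leaf
∉leaf ()

nodeAt⇒∈ : ∀ {T x l r} → NodeAt T x l r → x ∈ₜ T
nodeAt⇒∈ at      = here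
nodeAt⇒∈ (inL n) = left (nodeAt⇒∈ n)
nodeAt⇒∈ (inR n) = right (nodeAt⇒∈ n)

∈⇒nodeAt : ∀ {T x} → x ∈ₜ T → Σ Tree λ l → Σ Tree λ r → NodeAt T x l r
∈⇒nodeAt (here {l} {r}) = l , r , at
∈⇒nodeAt (left m) with ∈⇒nodeAt m
... | l , r , n = l , r , inL n
∈⇒nodeAt (right m) with ∈⇒nodeAt m
... | l , r , n = l , r , inR n

prefix-⊆ : ∀ {τ T x} → Prefix τ T → x ∈ₜ τ → x ∈ₜ T
prefix-⊆ (pnode p q) here      = here
prefix-⊆ (pnode p q) (left m)  = left (prefix-⊆ p m)
prefix-⊆ (pnode p q) (right m) = right (prefix-⊆ q m)

∈-left : ∀ {l k r v} → IsBST (node l k r) → v ∈ₜ node l k r → v < k → v ∈ₜ l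
∈-left _                 here      v<k = ⊥-elim (<-irrefl refl v<k)
∈-left _                 (left m)  _   = m
∈-left (_ , _ , _ , fr)  (right m) v<k = ⊥-elim (<-asym v<k (fr _ m))

∈-right : ∀ {l k r v} → IsBST (node l k r) → v ∈ₜ node l k r → k < v → v ∈ₜ r
∈-right _                here      k<v = ⊥-elim (<-irrefl refl k<v)
∈-right (_ , _ , fl , _) (left m)  k<v = ⊥-elim (<-asym k<v (fl _ m))
∈-right _                (right m) _   = m

nodeAt-left : ∀ {L k R x a b} → IsBST (node L k R) → x < k → NodeAt (node L k R) x a b → NodeAt L x a b
nodeAt-left _                x<k at      = ⊥-elim (<-irrefl refl x<k)
nodeAt-left _                _   (inL n) = n
nodeAt-left (_ , _ , _ , fr) x<k (inR n) = ⊥-elim (<-asym x<k (fr _ (nodeAt⇒∈ n)))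

nodeAt-right : ∀ {L k R x a b} → IsBST (node L k R) → k < x → NodeAt (node L k R) x a b → NodeAt R x a b
nodeAt-right _                k<x at      = ⊥-elim (<-irrefl refl k<x)
nodeAt-right (_ , _ , fl , _) k<x (inL n) = ⊥-elim (<-asym k<x (fl _ (nodeAt⇒∈ n)))
nodeAt-right _                _   (inR n) = n

right-split : ∀ {L k R lτ rτ b k'} → IsBST (node L k R) → Prefix lτ L →
              b ∈ₜ R → k' ∈ₜ node lτ k rτ → k' < b ⊎ k' ∈ₜ rτ
right-split (_ , _ , _ , fr)  _ bR here      = inj₁ (fr _ bR)
right-split (_ , _ , fl , fr) p bR (left z)  = inj₁ (<-trans (fl _ (prefix-⊆ p z)) (fr _ bR))
right-split _                 _ _  (right z) = inj₂ z

left-split : ∀ {L k R lτ rτ a k'} → IsBST (node L k R) → Prefix rτ R →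
             a ∈ₜ L → k' ∈ₜ node lτ k rτ → a < k' ⊎ k' ∈ₜ lτ
left-split (_ , _ , fl , _)  _ aL here      = inj₁ (fl _ aL)
left-split _                 _ _  (left z)  = inj₂ z
left-split (_ , _ , fl , fr) q aL (right z) = inj₁ (<-trans (fl _ aL) (fr _ (prefix-⊆ q z)))

Side : Bool → ℤ → ℤ → Set
Side true  k x = k < x
Side false k x = x < k

-- Pendant subtrees: walk down a prefix τ of T, turning right at key k iff
-- 'go k', and return the subtree of T hanging where τ ends.

module Pendant (go : ℤ → Bool) where

  pendant : Tree → Tree → Tree
  pendant leaf           T            = T
  pendant (node _ _ _)   leaf         = leaf
  pendant (node lτ _ rτ) (node L k R) = if go k then pendant rτ R else pendant lτ L

  pendant-nodes : ∀ τ T {x a b} → NodeAt (pendant τ T) x a b → NodeAt T x a b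
  pendant-nodes leaf           T            n = n
  pendant-nodes (node _ _ _)   leaf         ()
  pendant-nodes (node lτ _ rτ) (node L k R) n with go k
  ... | true  = inR (pendant-nodes rτ R n)
  ... | false = inL (pendant-nodes lτ L n)

  pendant-⊆ : ∀ τ T {x} → x ∈ₜ pendant τ T → x ∈ₜ T
  pendant-⊆ τ T m = nodeAt⇒∈ (pendant-nodes τ T (proj₂ (proj₂ (∈⇒nodeAt m))))

  pendant-bst : ∀ τ T → IsBST T → IsBST (pendant τ T)
  pendant-bst leaf           T            bT = bT
  pendant-bst (node _ _ _)   leaf         _  = tt
  pendant-bst (node lτ _ rτ) (node L k R) (bL , bR , _) with go k
  ... | true  = pendant-bst rτ R bR
  ... | false = pendant-bst lτ L bL

  pendant-outside : ∀ τ T {x} → IsBST T → Prefix τ T → x ∈ₜ pendant τ T → ¬ x ∈ₜ τ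
  pendant-outside leaf           T            _  _           _ ()
  pendant-outside (node _ _ _)   leaf         _  ()          _
  pendant-outside (node lτ _ rτ) (node L k R) bT (pnode p q) m xτ with go k
  ... | true  = [ <-irrefl refl , pendant-outside rτ R (proj₁ (proj₂ bT)) q m ]′
                  (right-split bT p (pendant-⊆ rτ R m) xτ)
  ... | false = [ <-irrefl refl , pendant-outside lτ L (proj₁ bT) p m ]′
                  (left-split bT q (pendant-⊆ lτ L m) xτ)

  pendant-same-side : ∀ τ T {a b k'} → IsBST T → Prefix τ T →
                      a ∈ₜ pendant τ T → b ∈ₜ pendant τ T → k' ∈ₜ τ → k' < a → k' < b
  pendant-same-side leaf           T            _  _           _  _  ()
  pendant-same-side (node _ _ _)   leaf         _  ()          _  _  _
  pendant-same-side (node lτ _ rτ) (node L k R) bT (pnode p q) ma mb k'τ k'<a with go k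
  ... | true  = [ (λ k'<b → k'<b) ,
                  (λ z → pendant-same-side rτ R (proj₁ (proj₂ bT)) q ma mb z k'<a) ]′
                  (right-split bT p (pendant-⊆ rτ R mb) k'τ)
  ... | false = [ (λ a<k' → ⊥-elim (<-asym k'<a a<k')) ,
                  (λ z → pendant-same-side lτ L (proj₁ bT) p ma mb z k'<a) ]′
                  (left-split bT q (pendant-⊆ lτ L ma) k'τ)

  pendant-reaches : ∀ τ T {x a b} → IsBST T → Prefix τ T → NodeAt T x a b → ¬ x ∈ₜ τ →
                    (∀ k → k ∈ₜ τ → Side (go k) k x) → NodeAt (pendant τ T) x a b
  pendant-reaches leaf           T            _  _           n _   _    = n
  pendant-reaches (node lτ _ rτ) (node L k R) bT (pnode p q) n x∉τ turn
    with go k | turn k here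
  ... | true  | k<x = pendant-reaches rτ R (proj₁ (proj₂ bT)) q (nodeAt-right bT k<x n)
                        (λ z → x∉τ (right z)) (λ k' z → turn k' (right z))
  ... | false | x<k = pendant-reaches lτ L (proj₁ bT) p (nodeAt-left bT x<k n)
                        (λ z → x∉τ (left z)) (λ k' z → turn k' (left z))

open Pendant

toward : Bool → Maybe ℤ → Maybe ℤ → ℤ → Bool
toward d lo hi k with above? lo k | below? hi k
... | no _  | _     = true
... | yes _ | no _  = false
... | yes _ | yes _ = d

toward-sound : ∀ d lo hi k {x} → Within lo hi x → (Within lo hi k → Side d k x) →
               Side (toward d lo hi k) k x
toward-sound d lo hi k (lo<x , x<hi) inside with above? lo k | below? hi k
... | no k≤lo  | _        = left-of-window lo k≤lo lo<x
... | yes _    | no hi≤k  = right-of-window hi hi≤k x<hi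
... | yes lo<k | yes k<hi = inside (lo<k , k<hi)

keepWithin : Maybe ℤ → Maybe ℤ → Tree → Tree
keepWithin lo hi leaf = leaf
keepWithin lo hi (node a s b) with within? lo hi s
... | yes _ = node a s b
... | no _  = leaf

Closed : Maybe ℤ → Maybe ℤ → Tree → Set
Closed lo hi S = ∀ {a b} → a ∈ₜ S → Within lo hi a → b ∈ₜ S → Within lo hi b

keep-⊆ : ∀ lo hi S {x} → x ∈ₜ keepWithin lo hi S → x ∈ₜ S
keep-⊆ lo hi leaf         ()
keep-⊆ lo hi (node a s b) m with within? lo hi s
... | yes _ = m
keep-⊆ lo hi (node a s b) () | no _

keep-id : ∀ lo hi S {x} → Closed lo hi S → x ∈ₜ S → Within lo hi x → keepWithin lo hi S ≡ S
keep-id lo hi leaf         _      _  _  = refl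
keep-id lo hi (node a s b) closed xS wx with within? lo hi s
... | yes _ = refl
... | no s∉ = ⊥-elim (s∉ (closed xS wx here))

keep-bstIn : ∀ lo hi S → IsBST S → Closed lo hi S → BSTIn lo hi (keepWithin lo hi S)
keep-bstIn lo hi leaf         _  _      = tt
keep-bstIn lo hi (node a s b) bS closed with within? lo hi s
... | yes ws = bst⇒bstIn bS (λ x m → closed here ws m)
... | no _   = tt

graft : (Maybe ℤ → Maybe ℤ → Tree) → Tree → Maybe ℤ → Maybe ℤ → Tree
graft g leaf         lo hi = g lo hi
graft g (node l k r) lo hi = node (graft g l lo (just k)) k (graft g r (just k) hi)

graft-keys : ∀ g t lo hi {x} → x ∈ₜ graft g t lo hi →
             x ∈ₜ t ⊎ Σ (Maybe ℤ) λ lo' → Σ (Maybe ℤ) λ hi' → x ∈ₜ g lo' hi'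
graft-keys g leaf         lo hi m = inj₂ (lo , hi , m)
graft-keys g (node l k r) lo hi here = inj₁ here
graft-keys g (node l k r) lo hi (left m) with graft-keys g l lo (just k) m
... | inj₁ z = inj₁ (left z)
... | inj₂ z = inj₂ z
graft-keys g (node l k r) lo hi (right m) with graft-keys g r (just k) hi m
... | inj₁ z = inj₁ (right z)
... | inj₂ z = inj₂ z

graft-⊇ : ∀ g t lo hi {x} → x ∈ₜ t → x ∈ₜ graft g t lo hi
graft-⊇ g (node l k r) lo hi here      = here
graft-⊇ g (node l k r) lo hi (left m)  = left (graft-⊇ g l lo (just k) m)
graft-⊇ g (node l k r) lo hi (right m) = right (graft-⊇ g r (just k) hi m)

graft-prefix : ∀ g t lo hi → Prefix t (graft g t lo hi)
graft-prefix g leaf         lo hi = pleaf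
graft-prefix g (node l k r) lo hi =
  pnode (graft-prefix g l lo (just k)) (graft-prefix g r (just k) hi)

-- The windows of the leaves of t have ends that are keys of t (or infinite);
-- K is any set of keys containing those of t.
module _ (K : ℤ → Set) (g : Maybe ℤ → Maybe ℤ → Tree) where

  graft-bstIn : ∀ t lo hi → (∀ lo' hi' → EndIn K lo' → EndIn K hi' → BSTIn lo' hi' (g lo' hi')) →
                BSTIn lo hi t → (∀ v → v ∈ₜ t → K v) → EndIn K lo → EndIn K hi →
                BSTIn lo hi (graft g t lo hi)
  graft-bstIn leaf         lo hi fits _ _ elo ehi = fits lo hi elo ehi
  graft-bstIn (node l k r) lo hi fits (wk , bl , br) inK elo ehi =
    wk , graft-bstIn l lo (just k) fits bl (λ v m → inK v (left m)) elo (inK k here)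
       , graft-bstIn r (just k) hi fits br (λ v m → inK v (right m)) (inK k here) ehi

  graft-lands : ∀ t lo hi {x a b} → BSTIn lo hi t → (∀ v → v ∈ₜ t → K v) →
                EndIn K lo → EndIn K hi → (∀ v → K v → Within lo hi v → v ∈ₜ t) →
                ¬ x ∈ₜ t → Within lo hi x →
                (∀ lo' hi' → EndIn K lo' → EndIn K hi' → Gap K lo' hi' → Within lo' hi' x →
                   NodeAt (g lo' hi') x a b) →
                NodeAt (graft g t lo hi) x a b
  graft-lands leaf lo hi _ _ elo ehi covers _ wx land =
    land lo hi elo ehi (λ v kv wv → ∉leaf (covers v kv wv)) wx
  graft-lands (node l k r) lo hi {x} bt@(wk , bl , br) inK elo ehi covers x∉t wx land
    with <-cmp x k
  ... | tri< x<k _ _ =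
    inL (graft-lands l lo (just k) bl (λ v m → inK v (left m)) elo (inK k here)
          (λ v kv wv → ∈-left (bstIn⇒bst bt) (covers v kv (window-left lo hi (proj₂ wk) wv)) (proj₂ wv))
          (λ m → x∉t (left m)) (proj₁ wx , x<k) land)
  ... | tri≈ _ refl _ = ⊥-elim (x∉t here)
  ... | tri> _ _ k<x =
    inR (graft-lands r (just k) hi br (λ v m → inK v (right m)) (inK k here) ehi
          (λ v kv wv → ∈-right (bstIn⇒bst bt) (covers v kv (window-right lo hi (proj₁ wk) wv)) (proj₁ wv))
          (λ m → x∉t (right m)) (k<x , proj₂ wx) land)

Outside : Tree → Tree → ℤ → Set
Outside T τ x = x ∈ₜ T × ¬ x ∈ₜ τ

Unseparated : Tree → ℤ → ℤ → Set
Unseparated τ a b = ∀ k → k ∈ₜ τ → (k < a → k < b) × (k < b → k < a)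

unseparated-between : ∀ {τ a b v} → Unseparated τ a b → v ∈ₜ τ → a < v → v < b → ⊥
unseparated-between sep vτ a<v v<b = <-asym a<v (proj₂ (sep _ vτ) v<b)

module Criterion (T τ τ' : Tree) (d : Bool) (bT : IsBST T) (pT : Prefix τ T) (bτ' : IsBST τ')
  (fresh    : ∀ v → v ∈ₜ τ' → ¬ Outside T τ v)
  (unsplit  : ∀ a b v → Outside T τ a → Outside T τ b → Unseparated τ a b →
              v ∈ₜ τ' → a < v → v < b → ⊥)
  (oriented : ∀ lo hi x k → Outside T τ x → k ∈ₜ τ → Within lo hi x → Within lo hi k →
              Gap (_∈ₜ τ') lo hi → Side d k x)
  where

  P : Maybe ℤ → Maybe ℤ → Tree
  P lo hi = pendant (toward d lo hi) τ T

  fill : Maybe ℤ → Maybe ℤ → Tree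
  fill lo hi = keepWithin lo hi (P lo hi)

  T₂ : Tree
  T₂ = graft fill τ' nothing nothing

  P-outside : ∀ lo hi {x} → x ∈ₜ P lo hi → Outside T τ x
  P-outside lo hi m = pendant-⊆ (toward d lo hi) τ T m , pendant-outside (toward d lo hi) τ T bT pT m

  P-unseparated : ∀ lo hi {a b} → a ∈ₜ P lo hi → b ∈ₜ P lo hi → Unseparated τ a b
  P-unseparated lo hi ma mb k kτ =
    pendant-same-side (toward d lo hi) τ T bT pT ma mb kτ ,
    pendant-same-side (toward d lo hi) τ T bT pT mb ma kτ

  P-below : ∀ lo hi {a b v} → a ∈ₜ P lo hi → b ∈ₜ P lo hi → v ∈ₜ τ' → a < v → b < v
  P-below lo hi {a} {b} {v} ma mb vτ' a<v with <-cmp b v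
  ... | tri< b<v _ _  = b<v
  ... | tri≈ _ refl _ = ⊥-elim (fresh b vτ' (P-outside lo hi mb))
  ... | tri> _ _ v<b  = ⊥-elim (unsplit a b v (P-outside lo hi ma) (P-outside lo hi mb)
                                  (P-unseparated lo hi ma mb) vτ' a<v v<b)

  P-above : ∀ lo hi {a b v} → a ∈ₜ P lo hi → b ∈ₜ P lo hi → v ∈ₜ τ' → v < a → v < b
  P-above lo hi {a} {b} {v} ma mb vτ' v<a with <-cmp v b
  ... | tri< v<b _ _  = v<b
  ... | tri≈ _ refl _ = ⊥-elim (fresh v vτ' (P-outside lo hi mb))
  ... | tri> _ _ b<v  = ⊥-elim (unsplit b a v (P-outside lo hi mb) (P-outside lo hi ma)
                                  (P-unseparated lo hi mb ma) vτ' b<v v<a)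

  P-closed : ∀ lo hi → EndIn (_∈ₜ τ') lo → EndIn (_∈ₜ τ') hi → Closed lo hi (P lo hi)
  P-closed lo hi elo ehi {a} {b} ma (lo<a , a<hi) mb = lower lo elo lo<a , upper hi ehi a<hi
    where
    lower : ∀ e → EndIn (_∈ₜ τ') e → Above e a → Above e b
    lower nothing  _   _   = tt
    lower (just v) vτ' v<a = P-above lo hi ma mb vτ' v<a
    upper : ∀ e → EndIn (_∈ₜ τ') e → Below e a → Below e b
    upper nothing  _   _   = tt
    upper (just v) vτ' a<v = P-below lo hi ma mb vτ' a<v

  fill-bstIn : ∀ lo hi → EndIn (_∈ₜ τ') lo → EndIn (_∈ₜ τ') hi → BSTIn lo hi (fill lo hi)
  fill-bstIn lo hi elo ehi =
    keep-bstIn lo hi (P lo hi) (pendant-bst (toward d lo hi) τ T bT) (P-closed lo hi elo ehi)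

  fill-lands : ∀ lo hi {x a b} → EndIn (_∈ₜ τ') lo → EndIn (_∈ₜ τ') hi → Gap (_∈ₜ τ') lo hi →
               NodeAt T x a b → ¬ x ∈ₜ τ → Within lo hi x → NodeAt (fill lo hi) x a b
  fill-lands lo hi {x} {a} {b} elo ehi gap n x∉τ wx =
    subst (λ t → NodeAt t x a b)
          (sym (keep-id lo hi (P lo hi) (P-closed lo hi elo ehi) (nodeAt⇒∈ reached) wx)) reached
    where
    reached : NodeAt (P lo hi) x a b
    reached = pendant-reaches (toward d lo hi) τ T bT pT n x∉τ
      (λ k kτ → toward-sound d lo hi k wx
                  (λ wk → oriented lo hi x k (nodeAt⇒∈ n , x∉τ) kτ wx wk gap))

  τ'-bstIn : BSTIn nothing nothing τ'
  τ'-bstIn = bst⇒bstIn bτ' (λ _ _ → tt , tt)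

  T₂-bst : IsBST T₂
  T₂-bst = bstIn⇒bst (graft-bstIn (_∈ₜ τ') fill τ' nothing nothing fill-bstIn
                         τ'-bstIn (λ _ m → m) tt tt)

  T₂-nodes : ∀ {x a b} → NodeAt T x a b → ¬ x ∈ₜ τ → NodeAt T₂ x a b
  T₂-nodes n x∉τ =
    graft-lands (_∈ₜ τ') fill τ' nothing nothing τ'-bstIn (λ _ m → m) tt tt (λ _ m _ → m)
      (λ xτ' → fresh _ xτ' (nodeAt⇒∈ n , x∉τ)) (tt , tt)
      (λ lo hi elo ehi gap wx → fill-lands lo hi elo ehi gap n x∉τ wx)

  T₂-keys : ∀ x → (x ∈ₜ T₂ → Outside T τ x ⊎ x ∈ₜ τ') × (Outside T τ x ⊎ x ∈ₜ τ' → x ∈ₜ T₂)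
  T₂-keys x = into , from
    where
    into : x ∈ₜ T₂ → Outside T τ x ⊎ x ∈ₜ τ'
    into m with graft-keys fill τ' nothing nothing m
    ... | inj₁ xτ'            = inj₂ xτ'
    ... | inj₂ (lo , hi , xf) = inj₁ (P-outside lo hi (keep-⊆ lo hi (P lo hi) xf))
    from : Outside T τ x ⊎ x ∈ₜ τ' → x ∈ₜ T₂
    from (inj₁ (xT , x∉τ)) = nodeAt⇒∈ (T₂-nodes (proj₂ (proj₂ (∈⇒nodeAt xT))) x∉τ)
    from (inj₂ xτ')        = graft-⊇ fill τ' nothing nothing xτ'

  valid : ValidReconf T τ τ'
  valid = T₂ , T₂-bst , T₂-keys , graft-prefix fill τ' nothing nothing ,
          λ k l r n k∉τ → l , r , T₂-nodes n k∉τ , refl , refl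

Anchored : Tree → Tree → ℤ → Set
Anchored T τ y = (Σ ℤ λ p → IsPred T y p × p ∈ₜ τ)
               ⊎ (Σ ℤ λ s → IsSucc T y s × s ∈ₜ τ)
               ⊎ (∀ x → x ∈ₜ T → y ≤ x)
               ⊎ (∀ x → x ∈ₜ T → x ≤ y)

-- The side of y on which the keys of T near y, outside τ, lie.
tieBreak : ∀ {T τ y} → Anchored T τ y → Bool
tieBreak (inj₁ _)               = true
tieBreak (inj₂ (inj₁ _))        = false
tieBreak (inj₂ (inj₂ (inj₁ _))) = true
tieBreak (inj₂ (inj₂ (inj₂ _))) = false

anchor-unsplit : ∀ {T τ y a b} → Anchored T τ y → a ∈ₜ T → b ∈ₜ T → ¬ b ∈ₜ τ →
                 Unseparated τ a b → a < y → y < b → ⊥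
anchor-unsplit (inj₁ (p , (_ , p<y , pmax) , pτ)) aT _ _ sep a<y y<b =
  <-irrefl refl (<-≤-trans (proj₂ (sep p pτ) (<-trans p<y y<b)) (pmax _ aT a<y))
anchor-unsplit {b = b} (inj₂ (inj₁ (s , (_ , y<s , smin) , sτ))) _ bT b∉τ sep a<y y<b with <-cmp s b
... | tri< s<b _ _  = <-asym (proj₂ (sep s sτ) s<b) (<-trans a<y y<s)
... | tri≈ _ refl _ = b∉τ sτ
... | tri> _ _ b<s  = <-irrefl refl (<-≤-trans b<s (smin b bT y<b))
anchor-unsplit (inj₂ (inj₂ (inj₁ ymin))) aT _ _ _ a<y _ = <-irrefl refl (<-≤-trans a<y (ymin _ aT))
anchor-unsplit (inj₂ (inj₂ (inj₂ ymax))) _ bT _ _ _ y<b = <-irrefl refl (<-≤-trans y<b (ymax _ bT))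

anchor-orients : ∀ {T τ τ' y lo hi x} (c : Anchored T τ y) →
                 (∀ p → p ∈ₜ τ → ¬ p ≡ y → p ∈ₜ τ') → y ∈ₜ τ → Outside T τ x →
                 Within lo hi x → Within lo hi y → Gap (_∈ₜ τ') lo hi → Side (tieBreak c) y x
anchor-orients {y = y} {lo} {hi} {x} c keep yτ (xT , x∉τ) wx wy gap with c | <-cmp y x
... | _ | tri≈ _ refl _ = ⊥-elim (x∉τ yτ)
... | inj₁ _ | tri< y<x _ _ = y<x
... | inj₁ (p , (_ , p<y , pmax) , pτ) | tri> _ _ x<y =
  ⊥-elim (gap p (keep p pτ (λ { refl → <-irrefl refl p<y }))
           (above-mono lo (pmax x xT x<y) (proj₁ wx) , below-mono hi (<⇒≤ p<y) (proj₂ wy)))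
... | inj₂ (inj₁ _) | tri> _ _ x<y = x<y
... | inj₂ (inj₁ (s , (_ , y<s , smin) , sτ)) | tri< y<x _ _ =
  ⊥-elim (gap s (keep s sτ (λ { refl → <-irrefl refl y<s }))
           (above-mono lo (<⇒≤ y<s) (proj₁ wy) , below-mono hi (smin x xT y<x) (proj₂ wx)))
... | inj₂ (inj₂ (inj₁ _)) | tri< y<x _ _ = y<x
... | inj₂ (inj₂ (inj₁ ymin)) | tri> _ _ x<y = ⊥-elim (<-irrefl refl (<-≤-trans x<y (ymin x xT)))
... | inj₂ (inj₂ (inj₂ _)) | tri> _ _ x<y = x<y
... | inj₂ (inj₂ (inj₂ ymax)) | tri< y<x _ _ = ⊥-elim (<-irrefl refl (<-≤-trans y<x (ymax x xT)))

insertion-valid : ∀ {T τ y} → IsBST T → Prefix τ T → Anchored T τ y → ¬ y ∈ₜ T →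
                  (τ' : Tree) → IsBST τ' →
                  (∀ x → (x ∈ₜ τ' → (x ∈ₜ τ ⊎ x ≡ y)) × ((x ∈ₜ τ ⊎ x ≡ y) → x ∈ₜ τ')) →
                  ValidReconf T τ τ'
insertion-valid {T} {τ} {y} bT pT c y∉T τ' bτ' keys =
  Criterion.valid T τ τ' (tieBreak c) bT pT bτ' fresh unsplit oriented
  where
  fresh : ∀ v → v ∈ₜ τ' → ¬ Outside T τ v
  fresh v vτ' (vT , v∉τ) with proj₁ (keys v) vτ'
  ... | inj₁ vτ  = v∉τ vτ
  ... | inj₂ refl = y∉T vT
  unsplit : ∀ a b v → Outside T τ a → Outside T τ b → Unseparated τ a b →
            v ∈ₜ τ' → a < v → v < b → ⊥
  unsplit a b v (aT , _) (bT' , b∉τ) sep vτ' a<v v<b with proj₁ (keys v) vτ'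
  ... | inj₁ vτ  = unseparated-between sep vτ a<v v<b
  ... | inj₂ refl = anchor-unsplit c aT bT' b∉τ sep a<v v<b
  oriented : ∀ lo hi x k → Outside T τ x → k ∈ₜ τ → Within lo hi x → Within lo hi k →
             Gap (_∈ₜ τ') lo hi → Side (tieBreak c) k x
  oriented _ _ _ k _ kτ _ wk gap = ⊥-elim (gap k (proj₂ (keys k) (inj₁ kτ)) wk)

deletion-valid : ∀ {T τ y} → IsBST T → Prefix τ T → Anchored T τ y → y ∈ₜ τ →
                 (τ' : Tree) → IsBST τ' →
                 (∀ x → (x ∈ₜ τ → (x ∈ₜ τ' ⊎ x ≡ y)) × ((x ∈ₜ τ' ⊎ x ≡ y) → x ∈ₜ τ)) →
                 ValidReconf T τ τ'
deletion-valid {T} {τ} {y} bT pT c yτ τ' bτ' keys =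
  Criterion.valid T τ τ' (tieBreak c) bT pT bτ' fresh unsplit oriented
  where
  τ'⊆τ : ∀ v → v ∈ₜ τ' → v ∈ₜ τ
  τ'⊆τ v vτ' = proj₂ (keys v) (inj₁ vτ')
  kept : ∀ p → p ∈ₜ τ → ¬ p ≡ y → p ∈ₜ τ'
  kept p pτ p≢y = [ (λ pτ' → pτ') , (λ p≡y → ⊥-elim (p≢y p≡y)) ]′ (proj₁ (keys p) pτ)
  fresh : ∀ v → v ∈ₜ τ' → ¬ Outside T τ v
  fresh v vτ' (_ , v∉τ) = v∉τ (τ'⊆τ v vτ')
  unsplit : ∀ a b v → Outside T τ a → Outside T τ b → Unseparated τ a b →
            v ∈ₜ τ' → a < v → v < b → ⊥
  unsplit _ _ v _ _ sep vτ' = unseparated-between sep (τ'⊆τ v vτ')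
  oriented : ∀ lo hi x k → Outside T τ x → k ∈ₜ τ → Within lo hi x → Within lo hi k →
             Gap (_∈ₜ τ') lo hi → Side (tieBreak c) k x
  oriented _ _ _ k out kτ wx wk gap with proj₁ (keys k) kτ
  ... | inj₁ kτ'  = ⊥-elim (gap k kτ' wk)
  ... | inj₂ refl = anchor-orients c kept yτ out wx wk gap

lemma17 : (T τ : Tree) (y : ℤ) → IsBST T → Prefix τ T → NonEmpty τ →
    ((Σ ℤ λ p → IsPred T y p × p ∈ₜ τ)
     ⊎ (Σ ℤ λ s → IsSucc T y s × s ∈ₜ τ)
     ⊎ (∀ x → x ∈ₜ T → y ≤ x)
     ⊎ (∀ x → x ∈ₜ T → x ≤ y)) →
    ((¬ (y ∈ₜ T) → (τ' : Tree) → IsBST τ' →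
        (∀ x → (x ∈ₜ τ' → (x ∈ₜ τ ⊎ x ≡ y)) × ((x ∈ₜ τ ⊎ x ≡ y) → x ∈ₜ τ')) →
        ValidReconf T τ τ')
     × (y ∈ₜ τ → (τ' : Tree) → IsBST τ' →
        (∀ x → (x ∈ₜ τ → (x ∈ₜ τ' ⊎ x ≡ y)) × ((x ∈ₜ τ' ⊎ x ≡ y) → x ∈ₜ τ)) →
        ¬ (y ∈ₜ τ') →
        ValidReconf T τ τ'))
lemma17 T τ y bT pT _ anchored =
  insertion-valid bT pT anchored ,
  λ yτ τ' bτ' keys _ → deletion-valid bT pT anchored yτ τ' bτ' keys
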